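{- For $e\ge1$ let $a_1,\dots,a_{2^e}$ be the $2^e$ odd integers $-(2^e-1),-(2^e-3),\dots,-1,1,\dots,2^e-3,2^e-1$, and let $\sigma_k$ denote the $k$-th elementary symmetric polynomial. Then for $e\ge1$, $$\sigma_{2^e-1}(a_1,\dots,a_{2^e})=0,$$ and for $e\ge2$, $$\nu_2\bigl(\sigma_{2^e-2}(a_1,\dots,a_{2^e})\bigr)=e-1.$$
   Context: $\nu_2$ is the exponent of $2$ in a nonzero integer. -}

module Defs where

open import Data.Nat as ℕ using (ℕ; zero; suc)
open import Data.Integer as ℤ using (ℤ; +_; -_; _+_; _*_)
open import Data.Integer.Divisibility using (_∣_)
open import Data.List using (List; []; _∷_; _++_; map; reverse; upTo)
open import Data.Product using (_×_)
open import Relation.Nullary using (¬_)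
open import Relation.Binary.PropositionalEquality using (_≡_)

σ : ℕ → List ℤ → ℤ
σ zero    _        = + 1
σ (suc k) []       = + 0
σ (suc k) (x ∷ xs) = x * σ k xs + σ (suc k) xs

posOdds : ℕ → List ℤ
posOdds e = map (λ i → + (1 ℕ.+ 2 ℕ.* i)) (upTo (2 ℕ.^ (e ℕ.∸ 1)))

oddList : ℕ → List ℤ
oddList e = reverse (map -_ (posOdds e)) ++ posOdds e

ν₂≡ : ℤ → ℕ → Set
ν₂≡ x n = ¬ (x ≡ + 0) × ((+ (2 ℕ.^ n)) ∣ x) × ¬ ((+ (2 ℕ.^ suc n)) ∣ x)

module Submission where

open import Defs
open import Data.Nat as ℕ using (ℕ; zero; suc; _≥_; _∸_; _^_; s≤s)
import Data.Nat.Properties as ℕ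
import Data.Nat.Divisibility as ℕ
import Data.Nat.Tactic.RingSolver as ℕ-Solver
open import Data.Integer as ℤ using (ℤ; +_; -_; _+_; _*_)
import Data.Integer.Properties as ℤ
open import Data.Integer.Divisibility.Signed as ℤ using (divides; ∣⇒∣ᵤ; ∣ᵤ⇒∣)
import Data.Integer.Divisibility as Unsigned
open import Data.Integer.Tactic.RingSolver using (solve-∀)
open import Data.List using (List; []; _∷_; _++_; map; length; upTo; applyUpTo)
open import Data.List.Properties using (map-++; map-∘; map-cong; map-upTo; length-map; length-upTo)
open import Data.List.Relation.Binary.Permutation.Propositional as ↭ using (_↭_)
open import Data.List.Relation.Binary.Permutation.Propositional.Properties using (↭-reverse; ↭-length; ++⁺ʳ; shift)
open import Data.Product using (_×_; _,_; ∃-syntax; proj₁; proj₂)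
open import Function using (_∘_; _$_)
open import Relation.Nullary using (¬_)
open import Relation.Binary.PropositionalEquality using (_≡_; refl; sym; trans; cong; cong₂; subst; subst₂; module ≡-Reasoning)
open ≡-Reasoning

-- Pairing a with −a turns ∏ (t + aᵢ) over the 2^e odd numbers into ∏ (t² − b²) over the
-- positive odd b. This polynomial is even, so its coefficient of t (that is σ_{2^e−1}) vanishes,
-- and its coefficient of t² (that is σ_{2^e−2}) is the coefficient of s in ∏ (s − b²).
-- The positive odd numbers below 2^(e+1) are those below 2^e together with their translates
-- by 2^e, whose negated squares agree with the originals modulo 2^(e+1). The product rule for
-- the two lowest coefficients then shows, by induction on e, that the constant coefficient of
-- ∏ (s − b²) stays odd while its coefficient of s gains exactly one factor 2 per doubling.

-- coσ k xs = σ (length xs ∸ k) xs, the coefficient of tᵏ in ∏ (t + x) over xs.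
coσ : ℕ → List ℤ → ℤ
coσ zero    []       = + 1
coσ (suc k) []       = + 0
coσ zero    (x ∷ xs) = x * coσ zero xs
coσ (suc k) (x ∷ xs) = x * coσ (suc k) xs + coσ k xs

σ-vanishes : ∀ k xs → length xs ℕ.< k → σ k xs ≡ + 0
σ-vanishes (suc k)       []       _          = refl
σ-vanishes (suc (suc k)) (x ∷ xs) (s≤s len<) =
  begin
    x * σ (suc k) xs + σ (suc (suc k)) xs
  ≡⟨ cong₂ (λ a b → x * a + b) (σ-vanishes (suc k) xs len<) (σ-vanishes (suc (suc k)) xs (ℕ.m<n⇒m<1+n len<)) ⟩
    x * + 0 + + 0
  ≡⟨ trans (ℤ.+-identityʳ _) (ℤ.*-zeroʳ x) ⟩
    + 0
  ∎

coσ-vanishes : ∀ k xs → length xs ℕ.< k → coσ k xs ≡ + 0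
coσ-vanishes (suc k) []       _          = refl
coσ-vanishes (suc k) (x ∷ xs) (s≤s len<) =
  begin
    x * coσ (suc k) xs + coσ k xs
  ≡⟨ cong₂ (λ a b → x * a + b) (coσ-vanishes (suc k) xs (ℕ.m<n⇒m<1+n len<)) (coσ-vanishes k xs len<) ⟩
    x * + 0 + + 0
  ≡⟨ trans (ℤ.+-identityʳ _) (ℤ.*-zeroʳ x) ⟩
    + 0
  ∎

σ≡coσ : ∀ m k xs → m ℕ.+ k ≡ length xs → σ m xs ≡ coσ k xs
σ≡coσ zero    zero    []       _    = refl
σ≡coσ zero    (suc k) (x ∷ xs) refl =
  begin
    + 1
  ≡⟨ σ≡coσ zero k xs refl ⟩
    coσ k xs
  ≡⟨ trans (cong (_+ coσ k xs) (ℤ.*-zeroʳ x)) (ℤ.+-identityˡ _) ⟨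
    x * + 0 + coσ k xs
  ≡⟨ cong (λ a → x * a + coσ k xs) (coσ-vanishes (suc k) xs ℕ.≤-refl) ⟨
    x * coσ (suc k) xs + coσ k xs
  ∎
σ≡coσ (suc m) zero    (x ∷ xs) eq =
  begin
    x * σ m xs + σ (suc m) xs
  ≡⟨ cong₂ (λ a b → x * a + b) (σ≡coσ m zero xs (ℕ.suc-injective eq)) (σ-vanishes (suc m) xs len<) ⟩
    x * coσ zero xs + + 0
  ≡⟨ ℤ.+-identityʳ _ ⟩
    x * coσ zero xs
  ∎
  where
  len< : length xs ℕ.< suc m
  len< = ℕ.≤-reflexive (trans (sym eq) (cong suc (ℕ.+-identityʳ m)))
σ≡coσ (suc m) (suc k) (x ∷ xs) eq =
  cong₂ (λ a b → x * a + b) (σ≡coσ m (suc k) xs (ℕ.suc-injective eq))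
                            (σ≡coσ (suc m) k xs (trans (sym (ℕ.+-suc m k)) (ℕ.suc-injective eq)))

coσ-∷-cong : ∀ x {xs ys} → (∀ k → coσ k xs ≡ coσ k ys) → ∀ k → coσ k (x ∷ xs) ≡ coσ k (x ∷ ys)
coσ-∷-cong x eq zero    = cong (x *_) (eq zero)
coσ-∷-cong x eq (suc k) = cong₂ (λ a b → x * a + b) (eq (suc k)) (eq k)

coσ-swap : ∀ x y xs k → coσ k (x ∷ y ∷ xs) ≡ coσ k (y ∷ x ∷ xs)
coσ-swap x y xs zero          = swap₀ x y (coσ zero xs)
  where
  swap₀ : ∀ x y c → x * (y * c) ≡ y * (x * c)
  swap₀ = solve-∀
coσ-swap x y xs (suc zero)    = swap₁ x y (coσ 1 xs) (coσ 0 xs)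
  where
  swap₁ : ∀ x y c₁ c₀ → x * (y * c₁ + c₀) + y * c₀ ≡ y * (x * c₁ + c₀) + x * c₀
  swap₁ = solve-∀
coσ-swap x y xs (suc (suc k)) = swap₂ x y (coσ (2 ℕ.+ k) xs) (coσ (1 ℕ.+ k) xs) (coσ k xs)
  where
  swap₂ : ∀ x y c₂ c₁ c₀ → x * (y * c₂ + c₁) + (y * c₁ + c₀) ≡ y * (x * c₂ + c₁) + (x * c₁ + c₀)
  swap₂ = solve-∀

coσ-↭ : ∀ {xs ys} → xs ↭ ys → ∀ k → coσ k xs ≡ coσ k ys
coσ-↭ ↭.refl         k = refl
coσ-↭ (↭.prep x p)   k = coσ-∷-cong x (coσ-↭ p) k
coσ-↭ (↭.swap x y p) k = trans (coσ-swap x y _ k) (coσ-∷-cong y (coσ-∷-cong x (coσ-↭ p)) k)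
coσ-↭ (↭.trans p q)  k = trans (coσ-↭ p k) (coσ-↭ q k)

±pairs : List ℤ → List ℤ
±pairs []       = []
±pairs (a ∷ as) = - a ∷ a ∷ ±pairs as

length-±pairs : ∀ as → length (±pairs as) ≡ 2 ℕ.* length as
length-±pairs []       = refl
length-±pairs (a ∷ as) = trans (cong (2 ℕ.+_) (length-±pairs as)) (sym (ℕ.*-suc 2 (length as)))

map-neg-++-↭-±pairs : ∀ as → map -_ as ++ as ↭ ±pairs as
map-neg-++-↭-±pairs []       = ↭.refl
map-neg-++-↭-±pairs (a ∷ as) =
  ↭.prep (- a) (↭.↭-trans (shift a (map -_ as) as) (↭.prep a (map-neg-++-↭-±pairs as)))

oddList-↭-±pairs : ∀ e → oddList e ↭ ±pairs (posOdds e)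
oddList-↭-±pairs e =
  ↭.↭-trans (++⁺ʳ (posOdds e) (↭-reverse (map -_ (posOdds e)))) (map-neg-++-↭-±pairs (posOdds e))

negSq : ℤ → ℤ
negSq a = - (a * a)

coσ-±pair : ∀ k a xs → coσ (2 ℕ.+ k) (- a ∷ a ∷ xs) ≡ negSq a * coσ (2 ℕ.+ k) xs + coσ k xs
coσ-±pair k a xs = pair a (coσ (2 ℕ.+ k) xs) (coσ (1 ℕ.+ k) xs) (coσ k xs)
  where
  pair : ∀ a c₂ c₁ c₀ → - a * (a * c₂ + c₁) + (a * c₁ + c₀) ≡ - (a * a) * c₂ + c₀
  pair = solve-∀

coσ-±pairs-odd : ∀ as j → coσ (1 ℕ.+ 2 ℕ.* j) (±pairs as) ≡ + 0
coσ-±pairs-odd []       j       = refl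
coσ-±pairs-odd (a ∷ as) zero    =
  trans (cong (λ c₁ → - a * (a * c₁ + c₀) + a * c₀) (coσ-±pairs-odd as 0)) (pair a c₀)
  where
  c₀ = coσ 0 (±pairs as)
  pair : ∀ a c₀ → - a * (a * + 0 + c₀) + a * c₀ ≡ + 0
  pair = solve-∀
coσ-±pairs-odd (a ∷ as) (suc j) =
  begin
    coσ (1 ℕ.+ 2 ℕ.* suc j) (- a ∷ a ∷ ±pairs as)
  ≡⟨ cong (λ n → coσ (1 ℕ.+ n) (- a ∷ a ∷ ±pairs as)) (ℕ.*-suc 2 j) ⟩
    coσ (2 ℕ.+ (1 ℕ.+ 2 ℕ.* j)) (- a ∷ a ∷ ±pairs as)
  ≡⟨ coσ-±pair (1 ℕ.+ 2 ℕ.* j) a (±pairs as) ⟩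
    negSq a * coσ (2 ℕ.+ (1 ℕ.+ 2 ℕ.* j)) (±pairs as) + coσ (1 ℕ.+ 2 ℕ.* j) (±pairs as)
  ≡⟨ cong₂ (λ c₂ c₀ → negSq a * c₂ + c₀) odd-suc (coσ-±pairs-odd as j) ⟩
    negSq a * + 0 + + 0
  ≡⟨ trans (ℤ.+-identityʳ _) (ℤ.*-zeroʳ (negSq a)) ⟩
    + 0
  ∎
  where
  odd-suc : coσ (2 ℕ.+ (1 ℕ.+ 2 ℕ.* j)) (±pairs as) ≡ + 0
  odd-suc = trans (cong (λ n → coσ (1 ℕ.+ n) (±pairs as)) (sym (ℕ.*-suc 2 j))) (coσ-±pairs-odd as (suc j))

coσ-±pairs-even : ∀ as j → coσ (2 ℕ.* j) (±pairs as) ≡ coσ j (map negSq as)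
coσ-±pairs-even []       zero    = refl
coσ-±pairs-even []       (suc j) = refl
coσ-±pairs-even (a ∷ as) zero    =
  trans (pair a (coσ 0 (±pairs as))) (cong (negSq a *_) (coσ-±pairs-even as 0))
  where
  pair : ∀ a c₀ → - a * (a * c₀) ≡ - (a * a) * c₀
  pair = solve-∀
coσ-±pairs-even (a ∷ as) (suc j) =
  begin
    coσ (2 ℕ.* suc j) (- a ∷ a ∷ ±pairs as)
  ≡⟨ cong (λ n → coσ n (- a ∷ a ∷ ±pairs as)) (ℕ.*-suc 2 j) ⟩
    coσ (2 ℕ.+ 2 ℕ.* j) (- a ∷ a ∷ ±pairs as)
  ≡⟨ coσ-±pair (2 ℕ.* j) a (±pairs as) ⟩
    negSq a * coσ (2 ℕ.+ 2 ℕ.* j) (±pairs as) + coσ (2 ℕ.* j) (±pairs as)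
  ≡⟨ cong₂ (λ c₂ c₀ → negSq a * c₂ + c₀) even-suc (coσ-±pairs-even as j) ⟩
    negSq a * coσ (suc j) (map negSq as) + coσ j (map negSq as)
  ∎
  where
  even-suc : coσ (2 ℕ.+ 2 ℕ.* j) (±pairs as) ≡ coσ (suc j) (map negSq as)
  even-suc = trans (cong (λ n → coσ n (±pairs as)) (sym (ℕ.*-suc 2 j))) (coσ-±pairs-even as (suc j))

coσ₀-++ : ∀ xs ys → coσ 0 (xs ++ ys) ≡ coσ 0 xs * coσ 0 ys
coσ₀-++ []       ys = sym (ℤ.*-identityˡ _)
coσ₀-++ (x ∷ xs) ys = trans (cong (x *_) (coσ₀-++ xs ys)) (sym (ℤ.*-assoc x _ _))

coσ₁-++ : ∀ xs ys → coσ 1 (xs ++ ys) ≡ coσ 0 xs * coσ 1 ys + coσ 1 xs * coσ 0 ys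
coσ₁-++ []       ys = base (coσ 1 ys) (coσ 0 ys)
  where
  base : ∀ c₁ c₀ → c₁ ≡ + 1 * c₁ + + 0 * c₀
  base = solve-∀
coσ₁-++ (x ∷ xs) ys =
  trans (cong₂ (λ c₁ c₀ → x * c₁ + c₀) (coσ₁-++ xs ys) (coσ₀-++ xs ys))
        (step x (coσ 0 xs) (coσ 1 xs) (coσ 0 ys) (coσ 1 ys))
  where
  step : ∀ x a₀ a₁ b₀ b₁ → x * (a₀ * b₁ + a₁ * b₀) + a₀ * b₀ ≡ x * a₀ * b₁ + (x * a₁ + a₀) * b₀
  step = solve-∀

record _≡_[mod_] (x y m : ℤ) : Set where
  constructor congruent
  field
    quotient : ℤ
    equality : x ≡ y + m * quotient

≡-mod-refl : ∀ {m} x → x ≡ x [mod m ]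
≡-mod-refl {m} x = congruent (+ 0) $ sym (trans (cong (λ y → x + y) (ℤ.*-zeroʳ m)) (ℤ.+-identityʳ x))

coσ-map-mod : ∀ {f g : ℤ → ℤ} {m} → (∀ x → f x ≡ g x [mod m ]) →
              ∀ k xs → coσ k (map f xs) ≡ coσ k (map g xs) [mod m ]
coσ-map-mod f≡g k [] = ≡-mod-refl (coσ k [])
coσ-map-mod {g = g} {m} f≡g zero (x ∷ xs)
  with f≡g x | coσ-map-mod f≡g zero xs
... | congruent s fx | congruent t c₀ = congruent _ $ trans (cong₂ _*_ fx c₀) (step (g x) (coσ 0 (map g xs)) m s t)
  where
  step : ∀ y c m s t → (y + m * s) * (c + m * t) ≡ y * c + m * (s * c + y * t + m * s * t)
  step = solve-∀
coσ-map-mod {g = g} {m} f≡g (suc k) (x ∷ xs)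
  with f≡g x | coσ-map-mod f≡g (suc k) xs | coσ-map-mod f≡g k xs
... | congruent s fx | congruent t c₁ | congruent u c₀ =
  congruent _ $ trans (cong₂ _+_ (cong₂ _*_ fx c₁) c₀) (step (g x) (coσ (suc k) (map g xs)) (coσ k (map g xs)) m s t u)
  where
  step : ∀ y c₁ c₀ m s t u → (y + m * s) * (c₁ + m * t) + (c₀ + m * u)
                              ≡ (y * c₁ + c₀) + m * (s * c₁ + y * t + m * s * t + u)
  step = solve-∀

negSq-shift : ∀ h a → negSq (a + + 2 * h) ≡ negSq a [mod + 2 * (+ 2 * h) ]
negSq-shift h a = congruent (- (a + h)) (expand a h)
  where
  expand : ∀ a h → - ((a + + 2 * h) * (a + + 2 * h)) ≡ - (a * a) + + 2 * (+ 2 * h) * - (a + h)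
  expand = solve-∀

Odd : ℤ → Set
Odd x = ∃[ m ] x ≡ + 1 + + 2 * m

OddMultiple : ℤ → ℤ → Set
OddMultiple h x = ∃[ u ] Odd u × x ≡ h * u

odd-* : ∀ {x y} → Odd x → Odd y → Odd (x * y)
odd-* (a , refl) (b , refl) = a + b + + 2 * a * b , expand a b
  where
  expand : ∀ a b → (+ 1 + + 2 * a) * (+ 1 + + 2 * b) ≡ + 1 + + 2 * (a + b + + 2 * a * b)
  expand = solve-∀

odd-+-even : ∀ {x} y → Odd x → Odd (x + + 2 * y)
odd-+-even y (a , refl) = a + y , regroup a y
  where
  regroup : ∀ a y → + 1 + + 2 * a + + 2 * y ≡ + 1 + + 2 * (a + y)
  regroup = solve-∀

odd⇒2∤ : ∀ {x} → Odd x → ¬ (+ 2 ℤ.∣ x)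
odd⇒2∤ (m , refl) 2∣x = 2≢1 (ℕ.∣1⇒≡1 (∣⇒∣ᵤ (ℤ.∣m+n∣n⇒∣m {m = + 1} 2∣x (ℤ.∣m⇒∣m*n m ℤ.∣-refl))))
  where
  2≢1 : ¬ (2 ≡ 1)
  2≢1 ()

oddMultiple⇒ν₂≡ : ∀ k {x} → OddMultiple (+ (2 ^ k)) x → ν₂≡ x k
oddMultiple⇒ν₂≡ k {x} (u , odd-u , refl) = nonzero , 2^k∣x , 2^1+k∤x
  where
  instance _ = ℕ.m^n≢0 2 k
  2^k∣x : + (2 ^ k) Unsigned.∣ x
  2^k∣x = ∣⇒∣ᵤ (divides u (ℤ.*-comm (+ (2 ^ k)) u))
  2^1+k : + (2 ^ suc k) ≡ + (2 ^ k) * + 2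
  2^1+k = trans (ℤ.pos-* 2 (2 ^ k)) (ℤ.*-comm (+ 2) (+ (2 ^ k)))
  2^1+k∤x : ¬ (+ (2 ^ suc k) Unsigned.∣ x)
  2^1+k∤x d = odd⇒2∤ odd-u (ℤ.*-cancelˡ-∣ (+ (2 ^ k)) (subst (ℤ._∣ x) 2^1+k (∣ᵤ⇒∣ d)))
  nonzero : ¬ (x ≡ + 0)
  nonzero x≡0 = 2^1+k∤x (subst (+ (2 ^ suc k) Unsigned.∣_) (sym x≡0) ((2 ^ suc k) ℕ.∣0))

coσ-++-doubling : ∀ h xs ys → (∀ k → coσ k ys ≡ coσ k xs [mod + 2 * (+ 2 * h) ]) →
                  Odd (coσ 0 xs) → OddMultiple h (coσ 1 xs) →
                  Odd (coσ 0 (xs ++ ys)) × OddMultiple (+ 2 * h) (coσ 1 (xs ++ ys))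
coσ-++-doubling h xs ys ys≡xs odd-p (u , odd-u , q≡hu) with ys≡xs 0 | ys≡xs 1
... | congruent t p′≡ | congruent v q′≡ = odd-pp′ , P * u + + 2 * w , odd-+-even w (odd-* odd-p odd-u) , qq′
  where
  P = coσ 0 xs
  Q = coσ 1 xs
  w = P * v + h * u * t
  odd-p′ : Odd (coσ 0 ys)
  odd-p′ = subst Odd (sym (trans p′≡ (cong (λ y → P + y) (ℤ.*-assoc (+ 2) (+ 2 * h) t))))
                     (odd-+-even (+ 2 * h * t) odd-p)
  odd-pp′ : Odd (coσ 0 (xs ++ ys))
  odd-pp′ = subst Odd (sym (coσ₀-++ xs ys)) (odd-* odd-p odd-p′)
  qq′ : coσ 1 (xs ++ ys) ≡ + 2 * h * (P * u + + 2 * w)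
  qq′ =
    begin
      coσ 1 (xs ++ ys)
    ≡⟨ coσ₁-++ xs ys ⟩
      P * coσ 1 ys + Q * coσ 0 ys
    ≡⟨ cong₂ (λ q′ p′ → P * q′ + Q * p′) q′≡ p′≡ ⟩
      P * (Q + + 2 * (+ 2 * h) * v) + Q * (P + + 2 * (+ 2 * h) * t)
    ≡⟨ cong (λ q → P * (q + + 2 * (+ 2 * h) * v) + q * (P + + 2 * (+ 2 * h) * t)) q≡hu ⟩
      P * (h * u + + 2 * (+ 2 * h) * v) + h * u * (P + + 2 * (+ 2 * h) * t)
    ≡⟨ expand P h u v t ⟩
      + 2 * h * (P * u + + 2 * w)
    ∎
    where
    expand : ∀ p h u v t → p * (h * u + + 2 * (+ 2 * h) * v) + h * u * (p + + 2 * (+ 2 * h) * t)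
                           ≡ + 2 * h * (p * u + + 2 * (p * v + h * u * t))
    expand = solve-∀

applyUpTo-+ : ∀ {A : Set} (f : ℕ → A) m n → applyUpTo f (m ℕ.+ n) ≡ applyUpTo f m ++ applyUpTo (f ∘ (m ℕ.+_)) n
applyUpTo-+ f zero    n = refl
applyUpTo-+ f (suc m) n = cong (f 0 ∷_) (applyUpTo-+ (f ∘ suc) m n)

oddNumber : ℕ → ℤ
oddNumber i = + (1 ℕ.+ 2 ℕ.* i)

oddNumber-+ : ∀ n i → oddNumber (n ℕ.+ i) ≡ oddNumber i + + 2 * + n
oddNumber-+ n i =
  begin
    + (1 ℕ.+ 2 ℕ.* (n ℕ.+ i))
  ≡⟨ cong +_ (regroup n i) ⟩
    + ((1 ℕ.+ 2 ℕ.* i) ℕ.+ 2 ℕ.* n)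
  ≡⟨ ℤ.pos-+ (1 ℕ.+ 2 ℕ.* i) (2 ℕ.* n) ⟩
    oddNumber i + + (2 ℕ.* n)
  ≡⟨ cong (λ y → oddNumber i + y) (ℤ.pos-* 2 n) ⟩
    oddNumber i + + 2 * + n
  ∎
  where
  regroup : ∀ n i → 1 ℕ.+ 2 ℕ.* (n ℕ.+ i) ≡ (1 ℕ.+ 2 ℕ.* i) ℕ.+ 2 ℕ.* n
  regroup = ℕ-Solver.solve-∀

posOdds-double : ∀ k → posOdds (2 ℕ.+ k) ≡ posOdds (1 ℕ.+ k) ++ map (_+ + 2 * + (2 ^ k)) (posOdds (1 ℕ.+ k))
posOdds-double k =
  begin
    map oddNumber (upTo (N ℕ.+ (N ℕ.+ 0)))
  ≡⟨ cong (map oddNumber ∘ upTo ∘ (N ℕ.+_)) (ℕ.+-identityʳ N) ⟩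
    map oddNumber (upTo (N ℕ.+ N))
  ≡⟨ map-upTo oddNumber (N ℕ.+ N) ⟩
    applyUpTo oddNumber (N ℕ.+ N)
  ≡⟨ applyUpTo-+ oddNumber N N ⟩
    applyUpTo oddNumber N ++ applyUpTo (oddNumber ∘ (N ℕ.+_)) N
  ≡⟨ cong₂ _++_ (map-upTo oddNumber N) (map-upTo (oddNumber ∘ (N ℕ.+_)) N) ⟨
    map oddNumber (upTo N) ++ map (oddNumber ∘ (N ℕ.+_)) (upTo N)
  ≡⟨ cong (map oddNumber (upTo N) ++_) (trans (map-cong (oddNumber-+ N) (upTo N)) (map-∘ (upTo N))) ⟩
    map oddNumber (upTo N) ++ map (_+ + 2 * + N) (map oddNumber (upTo N))
  ∎
  where
  N = 2 ^ k

coσ-negSq-posOdds : ∀ k → Odd (coσ 0 (map negSq (posOdds (suc k))))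
                        × OddMultiple (+ (2 ^ k)) (coσ 1 (map negSq (posOdds (suc k))))
coσ-negSq-posOdds zero    = (ℤ.-[1+ 0 ] , refl) , + 1 , (+ 0 , refl) , refl
coσ-negSq-posOdds (suc k) =
  subst₂ (λ h xs → Odd (coσ 0 xs) × OddMultiple h (coσ 1 xs)) (sym (ℤ.pos-* 2 (2 ^ k))) (sym split)
         (coσ-++-doubling h xs ys (λ j → coσ-map-mod (negSq-shift h) j A) odd-p q)
  where
  A = posOdds (suc k)
  h = + (2 ^ k)
  xs = map negSq A
  ys = map (negSq ∘ (_+ + 2 * h)) A
  odd-p = proj₁ (coσ-negSq-posOdds k)
  q = proj₂ (coσ-negSq-posOdds k)
  split : map negSq (posOdds (2 ℕ.+ k)) ≡ xs ++ ys
  split = trans (cong (map negSq) (posOdds-double k)) (trans (map-++ negSq A _) (cong (xs ++_) (sym (map-∘ A))))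

length-oddList : ∀ k → length (oddList (suc k)) ≡ 2 ^ suc k
length-oddList k =
  begin
    length (oddList (suc k))
  ≡⟨ ↭-length (oddList-↭-±pairs (suc k)) ⟩
    length (±pairs (posOdds (suc k)))
  ≡⟨ length-±pairs (posOdds (suc k)) ⟩
    2 ℕ.* length (posOdds (suc k))
  ≡⟨ cong (2 ℕ.*_) (trans (length-map oddNumber (upTo (2 ^ k))) (length-upTo (2 ^ k))) ⟩
    2 ^ suc k
  ∎

σ-oddList≡coσ-±pairs : ∀ j k → j ℕ.≤ 2 ^ suc k →
                       σ (2 ^ suc k ∸ j) (oddList (suc k)) ≡ coσ j (±pairs (posOdds (suc k)))
σ-oddList≡coσ-±pairs j k j≤ =
  trans (σ≡coσ (2 ^ suc k ∸ j) j (oddList (suc k)) (trans (ℕ.m∸n+n≡m j≤) (sym (length-oddList k))))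
        (coσ-↭ (oddList-↭-±pairs (suc k)) j)

lemma4p2 : ((e : ℕ) → e ≥ 1 → σ (2 ^ e ∸ 1) (oddList e) ≡ + 0)
           × ((e : ℕ) → e ≥ 2 → ν₂≡ (σ (2 ^ e ∸ 2) (oddList e)) (e ∸ 1))
lemma4p2 = σ-top , ν₂-σ-subtop
  where
  σ-top : (e : ℕ) → e ≥ 1 → σ (2 ^ e ∸ 1) (oddList e) ≡ + 0
  σ-top (suc k) _ = trans (σ-oddList≡coσ-±pairs 1 k (ℕ.m^n>0 2 (suc k))) (coσ-±pairs-odd (posOdds (suc k)) 0)

  ν₂-σ-subtop : (e : ℕ) → e ≥ 2 → ν₂≡ (σ (2 ^ e ∸ 2) (oddList e)) (e ∸ 1)
  ν₂-σ-subtop (suc zero)    (s≤s ())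
  ν₂-σ-subtop (suc (suc k)) _ =
    subst (λ x → ν₂≡ x (suc k)) (sym σ≡coσ₁) (oddMultiple⇒ν₂≡ (suc k) (proj₂ (coσ-negSq-posOdds (suc k))))
    where
    instance _ = ℕ.m^n≢0 2 (suc k)
    σ≡coσ₁ : σ (2 ^ suc (suc k) ∸ 2) (oddList (suc (suc k))) ≡ coσ 1 (map negSq (posOdds (suc (suc k))))
    σ≡coσ₁ = trans (σ-oddList≡coσ-±pairs 2 (suc k) (ℕ.m≤m*n 2 (2 ^ suc k)))
                   (coσ-±pairs-even (posOdds (suc (suc k))) 1)
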